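{- Let $G$ be a graph with exit set $X$, let $B\ge 0$ be an integer and let $Z$ be a zone of a $B$-partition of $G$. If $Z$ is not self-sufficient, then there exists an algorithm that groups the agents in $\mathcal{A}(Z)$ in at most $B$ steps, i.e., after at most $B$ steps of its execution the agents of $\mathcal{A}(Z)$ form a group.
   Context: Evacuation model: finite simple undirected graph $G=(V,E)$ with unique vertex identifiers, nonempty exit set $X\subseteq V$, homebases $H\subseteq V\setminus X$ with one agent (unique id) initially at each; agents know $G$ and $X$ but not $H$. In each synchronous step agents at distance at most 2 may exchange messages, then each agent moves to a neighbor or stays; moves are simultaneous and no two agents may share a vertex after the moves (swaps allowed); an agent at an exit at the end of a step evacuates. A $B$-partition of $G$ is a partition $(V_1,\dots,V_l)$ of $V$ into pairwise disjoint sets such that for each $i$ there is a spanning tree of $G[V_i\setminus X]$ with a root $v_i\in V_i$ such that every $v\in V_i$ is at distance at most $B$ from $v_i$ along the tree; each $V_i$ is a zone. $\mathcal{A}(Z)$ is the set of agents whose homebase lies in zone $Z$. An evacuation strategy is internal for $\mathcal{A}(Z)$ if during its execution all agents of $\mathcal{A}(Z)$ remain on vertices of $Z$; $Z$ is self-sufficient (w.r.t. $B$) if there exists an internal evacuation strategy for $\mathcal{A}(Z)$ that can be computed by the agents and completed in $B$ steps. For an agent $a$, $N[a]$ is the set consisting of the vertex occupied by $a$ and its neighbors. A set of agents $A$ forms a group if the subgraph of $G$ induced by $\bigcup_{a\in A}N[a]$ is connected; a strategy groups a set of agents if at the end of its execution these agents form a group. -}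

module Defs where

open import Data.Nat using (ℕ; zero; suc; _≤_; _<_)
open import Data.Fin using (Fin; _≟_)
open import Data.Bool using (Bool; true; false; _∧_; _∨_; if_then_else_; not)
open import Data.Maybe using (Maybe; just; nothing)
import Data.Maybe as Maybe
open import Data.List using (List; []; _∷_; allFin; foldr)
open import Data.Bool.ListAction using (any)
open import Data.Product using (Σ; ∃; ∃-syntax; _×_; _,_; proj₁; proj₂)
open import Data.Sum using (_⊎_)
open import Relation.Binary.PropositionalEquality using (_≡_; _≢_)
open import Relation.Nullary using (¬_; does)

record Graph (n : ℕ) : Set where
  field
    adj    : Fin n → Fin n → Bool
    sym    : ∀ u v → adj u v ≡ adj v u
    irrefl : ∀ u → adj u u ≡ false

open Graph public

iter : {A : Set} → (A → A) → ℕ → A → A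
iter f zero    x = x
iter f (suc d) x = f (iter f d x)

data Walk {n : ℕ} (G : Graph n) (P : Fin n → Set) : Fin n → Fin n → Set where
  here : ∀ {u} → P u → Walk G P u u
  next : ∀ {u v w} → P u → adj G u v ≡ true → Walk G P v w → Walk G P u w

Connected : {n : ℕ} → Graph n → (Fin n → Set) → Set
Connected G P = ∀ u v → P u → P v → Walk G P u v

-- A partition of V into l nonempty parts is given by the
-- zone-assignment map  zone : Fin n → Fin l  (zone i = { v | zone v ≡ i }).
-- A rooted spanning tree of G[V_i \ X] is given by a root r ∈ V_i \ X and a
-- parent map par (edges {v , par v} for v ≠ r); the tree distance from v to
-- r is the number of parent steps needed to reach r.

IsBPartition : {n : ℕ} → Graph n → (X : Fin n → Bool) → (B : ℕ) →
               {l : ℕ} → (Fin n → Fin l) → Set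
IsBPartition {n} G X B {l} zone =
  (∀ i → ∃[ v ] zone v ≡ i) ×
  (∀ i → ∃[ r ] ∃[ par ]
     (zone r ≡ i × X r ≡ false ×
      (∀ v → zone v ≡ i → X v ≡ false → v ≢ r →
         zone (par v) ≡ i × X (par v) ≡ false × adj G v (par v) ≡ true) ×
      (∀ v → zone v ≡ i → X v ≡ false →
         ∃[ d ] (d ≤ B × iter par d v ≡ r))))

module Evac {n : ℕ} (G : Graph n) (X : Fin n → Bool) where

  near2 : Fin n → Fin n → Bool
  near2 u v = does (u ≟ v) ∨ adj G u v ∨ any (λ w → adj G u w ∧ adj G w v) (allFin n)

  -- Every agent runs the same
  -- program; it knows G and X (the algorithm may depend on them), its own
  -- identifier and its starting vertex.  In each step an agent receives the
  -- full local states of all agents at distance ≤ 2 (indexed by the vertex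
  -- they occupy; nothing = no agent there / too far), and computes its new
  -- state and the vertex it moves to.
  record Algorithm : Set₁ where
    field
      State : Set
      init  : ℕ → Fin n → State
      step  : State → (Fin n → Maybe State) → State × Fin n

  record Agents : Set where
    field
      k     : ℕ
      home  : Fin k → Fin n
      ident : Fin k → ℕ

  ValidAgents : Agents → Set
  ValidAgents A =
    (∀ a b → Agents.home A a ≡ Agents.home A b → a ≡ b) ×
    (∀ a b → Agents.ident A a ≡ Agents.ident A b → a ≡ b) ×
    (∀ a → X (Agents.home A a) ≡ false)

  module Run (alg : Algorithm) (A : Agents) where
    open Algorithm alg
    open Agents A

    record Config : Set where
      field
        loc  : Fin k → Fin n
        gone : Fin k → Bool
        st   : Fin k → State
    open Config public

    occupant : Config → Fin n → Maybe (Fin k)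
    occupant c u =
      foldr (λ a r → if not (gone c a) ∧ does (loc c a ≟ u) then just a else r)
            nothing (allFin k)

    view : Config → Fin k → Fin n → Maybe State
    view c a u =
      if near2 (loc c a) u ∧ not (does (loc c a ≟ u))
      then Maybe.map (st c) (occupant c u) else nothing

    decision : Config → Fin k → State × Fin n
    decision c a = step (st c a) (view c a)

    target : Config → Fin k → Fin n
    target c a = proj₂ (decision c a)

    nextConfig : Config → Config
    nextConfig c = record
      { loc  = λ a → if gone c a then loc c a else target c a
      ; gone = λ a → if gone c a then true else X (target c a)
      ; st   = λ a → if gone c a then st c a else proj₁ (decision c a)
      }

    initConfig : Config
    initConfig = record
      { loc = home ; gone = λ _ → false ; st = λ a → init (ident a) (home a) }

    run : ℕ → Config
    run zero    = initConfig
    run (suc t) = nextConfig (run t)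

    ValidStep : Config → Set
    ValidStep c =
      (∀ a → gone c a ≡ false →
         target c a ≡ loc c a ⊎ adj G (loc c a) (target c a) ≡ true) ×
      (∀ a b → a ≢ b → gone c a ≡ false → gone c b ≡ false →
         target c a ≢ target c b)

    ValidUpTo : ℕ → Set
    ValidUpTo t = ∀ t' → t' < t → ValidStep (run t')

  module _ {l : ℕ} (zone : Fin n → Fin l) (i : Fin l) where

    InAZ : (A : Agents) → Fin (Agents.k A) → Set
    InAZ A a = zone (Agents.home A a) ≡ i

    SelfSufficient : ℕ → Agents → Set₁
    SelfSufficient B A = ∃[ alg ] ∃[ t ]
      (t ≤ B × Run.ValidUpTo alg A t ×
       (∀ a → InAZ A a → Run.gone (Run.run alg A t) a ≡ true) ×
       (∀ t' → t' ≤ t → ∀ a → InAZ A a →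
          zone (Run.loc (Run.run alg A t') a) ≡ i))

    FormGroup : (alg : Algorithm) (A : Agents) → Run.Config alg A → Set
    FormGroup alg A c =
      (∀ a → InAZ A a → Run.gone c a ≡ false) ×
      Connected G (λ u → ∃[ a ] (InAZ A a × Run.gone c a ≡ false ×
                     (Run.loc c a ≡ u ⊎ adj G (Run.loc c a) u ≡ true)))

    GroupsWithin : Algorithm → Agents → ℕ → Set
    GroupsWithin alg A B = ∃[ t ]
      (t ≤ B × Run.ValidUpTo alg A t × FormGroup alg A (Run.run alg A t))

{-# OPTIONS --safe #-}
module Submission where

-- Every agent climbs the spanning tree of its zone: it moves to its parent vertex when it sees
-- that vertex free and no occupied sibling with a smaller vertex identifier competes for it.
-- Agents thus stay in their zone, never reach an exit and never collide. By induction on t,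
-- after t steps every agent is within B − t tree steps of the root, at the root, or has an agent
-- on its parent or grandparent: an occupied parent stays occupied unless its agent climbs one
-- step further, and a free parent with waiting children is entered by the smallest of them.
-- After B steps the first case is impossible, so from every agent of the zone a chain of
-- overlapping closed neighbourhoods of agents of the zone leads to its root.

open import Defs hiding (sym)
open import Data.Nat using (ℕ; zero; suc; _+_; _≤_; s≤s)
open import Data.Nat.Properties using (≤-refl; ≤-trans; +-identityʳ; +-suc; m≤n+m; 1+n≰n)
open import Data.Fin using (Fin; _≟_; _<_; _<?_)
open import Data.Fin.Properties using (any?; <-cmp; <⇒≢)
open import Data.Fin.Induction using (<-wellFounded)
open import Data.Bool using (Bool; true; false; T; _∧_; _∨_; not; if_then_else_)
open import Data.Bool.Properties using (T-≡; T-∧; T-not-≡; ∨-zeroʳ)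
open import Data.Maybe using (Maybe; just; nothing)
open import Data.Maybe.Properties using (≡-dec)
open import Data.List using (List; _∷_; allFin; foldr)
open import Data.List.Membership.Propositional using (_∈_)
open import Data.List.Membership.Propositional.Properties using (∈-allFin)
open import Data.List.Relation.Unary.Any using (here; there)
import Data.List.Relation.Unary.Any as Any
open import Data.List.Relation.Unary.Any.Properties using (any⁺)
open import Data.Product using (∃; ∃-syntax; _×_; _,_; proj₁; proj₂)
open import Data.Sum using (_⊎_; inj₁; inj₂; [_,_])
open import Data.Empty using (⊥-elim)
open import Function using (_∘_; Equivalence)
open import Induction.WellFounded using (Acc; acc)
open import Relation.Binary using (tri<; tri≈; tri>)
open import Relation.Binary.PropositionalEquality
  using (_≡_; _≢_; refl; sym; trans; cong; subst; ≢-sym)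
open import Relation.Nullary using (¬_; Dec; does; yes; no; ¬?; _×-dec_)
open import Relation.Nullary.Decidable
  using (toWitness; isYes≗does; dec-true; dec-false; decidable-stable)

open Equivalence using (to; from)

iter-suc : ∀ {A : Set} (f : A → A) d x → iter f (suc d) x ≡ iter f d (f x)
iter-suc f zero    x = refl
iter-suc f (suc d) x = cong f (iter-suc f d x)

module _ {A : Set} (p : A → Bool) where

  firstMatch : List A → Maybe A
  firstMatch = foldr (λ a r → if p a then just a else r) nothing

  firstMatch-sound : ∀ xs {b} → firstMatch xs ≡ just b → T (p b)
  firstMatch-sound (x ∷ xs) e with p x in px
  ... | true with refl ← e = from T-≡ px
  ... | false = firstMatch-sound xs e

  firstMatch-complete : ∀ {xs b} → b ∈ xs → T (p b) → firstMatch xs ≢ nothing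
  firstMatch-complete {x ∷ xs} b∈ pb e with p x in px
  firstMatch-complete {x ∷ xs} b∈ pb () | true
  firstMatch-complete {x ∷ xs} (here refl) pb e | false = subst T px pb
  firstMatch-complete {x ∷ xs} (there b∈) pb e | false = firstMatch-complete b∈ pb e

module _ {n} {G : Graph n} {P : Fin n → Set} where

  walk-start : ∀ {u v} → Walk G P u v → P u
  walk-start (here pu)     = pu
  walk-start (next pu _ _) = pu

  _++ʷ_ : ∀ {u v w} → Walk G P u v → Walk G P v w → Walk G P u w
  here _       ++ʷ q = q
  next pu e p ++ʷ q = next pu e (p ++ʷ q)

  reverseʷ : ∀ {u v} → Walk G P u v → Walk G P v u
  reverseʷ (here pu) = here pu
  reverseʷ (next {u} {v} pu e p) =
    reverseʷ p ++ʷ next (walk-start p) (trans (Graph.sym G v u) e) (here pu)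

  connected-via : (r : Fin n) → (∀ u → P u → Walk G P u r) → Connected G P
  connected-via r to-r u w pu pw = to-r u pu ++ʷ reverseʷ (to-r w pw)

adj⇒≢ : ∀ {n} (G : Graph n) {u v} → adj G u v ≡ true → u ≢ v
adj⇒≢ G {u} e refl with () ← trans (sym e) (irrefl G u)

module Distance2 {n} (G : Graph n) (X : Fin n → Bool) where
  open Evac G X

  near2-adj : ∀ {u v} → adj G u v ≡ true → near2 u v ≡ true
  near2-adj {u} {v} e rewrite e = ∨-zeroʳ (does (u ≟ v))

  near2-path : ∀ {u w v} → adj G u w ≡ true → adj G w v ≡ true → near2 u v ≡ true
  near2-path {u} {w} {v} e₁ e₂
    rewrite to T-≡ (any⁺ (λ x → adj G u x ∧ adj G x v)
                         (Any.map (λ { refl → from T-∧ (from T-≡ e₁ , from T-≡ e₂) })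
                                  (∈-allFin w)))
    = trans (cong (does (u ≟ v) ∨_) (∨-zeroʳ (adj G u v))) (∨-zeroʳ (does (u ≟ v)))

module RunFacts {n} (G : Graph n) (X : Fin n → Bool)
                (alg : Evac.Algorithm G X) (A : Evac.Agents G X) where
  open Evac G X
  open Agents A
  open Run alg A

  occupant-sound : ∀ c u {b} → occupant c u ≡ just b → gone c b ≡ false × loc c b ≡ u
  occupant-sound c u {b} e =
    let present , located = to T-∧ (firstMatch-sound _ (allFin k) e)
    in to T-not-≡ present , toWitness (subst T (sym (isYes≗does (loc c b ≟ u))) located)

  occupant-complete : ∀ c u {b} → gone c b ≡ false → loc c b ≡ u → occupant c u ≢ nothing
  occupant-complete c u {b} g l =
    firstMatch-complete _ (∈-allFin b)
      (from T-∧ (from T-not-≡ g , from T-≡ (dec-true (loc c b ≟ u) l)))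

  view-sound : ∀ c a u → view c a u ≢ nothing → ∃[ b ] (gone c b ≡ false × loc c b ≡ u)
  view-sound c a u seen with near2 (loc c a) u ∧ not (does (loc c a ≟ u))
  ... | false = ⊥-elim (seen refl)
  ... | true with occupant c u in eq
  ...   | just b  = b , occupant-sound c u eq
  ...   | nothing = ⊥-elim (seen refl)

  view-complete : ∀ c a u {b} → near2 (loc c a) u ≡ true → loc c a ≢ u →
                  gone c b ≡ false → loc c b ≡ u → view c a u ≢ nothing
  view-complete c a u near ne g l rewrite near | dec-false (loc c a ≟ u) ne
    with occupant c u in eq
  ... | just _  = λ ()
  ... | nothing = ⊥-elim (occupant-complete c u g l eq)

  module _ {c : Config} {a : Fin k} (present : gone c a ≡ false) where

    loc-next : loc (nextConfig c) a ≡ target c a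
    loc-next = cong (λ g → if g then loc c a else target c a) present

    gone-next : gone (nextConfig c) a ≡ X (target c a)
    gone-next = cong (λ g → if g then true else X (target c a)) present

    st-next : st (nextConfig c) a ≡ proj₁ (decision c a)
    st-next = cong (λ g → if g then st c a else proj₁ (decision c a)) present

module ZoneTrees {n} (G : Graph n) (X : Fin n → Bool) {B l} {zone : Fin n → Fin l}
                 (P : IsBPartition G X B zone) where

  root : Fin l → Fin n
  root i = proj₁ (proj₂ P i)

  parentIn : Fin l → Fin n → Fin n
  parentIn i = proj₁ (proj₂ (proj₂ P i))

  rootOf : Fin n → Fin n
  rootOf v = root (zone v)

  parent : Fin n → Fin n
  parent v = parentIn (zone v) v

  parent-spec : ∀ {v} → X v ≡ false → v ≢ rootOf v →
                zone (parent v) ≡ zone v × X (parent v) ≡ false × adj G v (parent v) ≡ true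
  parent-spec {v} xv ne =
    proj₁ (proj₂ (proj₂ (proj₂ (proj₂ (proj₂ P (zone v)))))) v refl xv ne

  data DepthAtMost : Fin n → ℕ → Set where
    isRoot    : ∀ {v d} → v ≡ rootOf v → DepthAtMost v d
    viaParent : ∀ {v d} → v ≢ rootOf v → DepthAtMost (parent v) d → DepthAtMost v (suc d)

  depthAtMost-iter : ∀ d {v} → X v ≡ false → iter (parentIn (zone v)) d v ≡ rootOf v →
                     DepthAtMost v d
  depthAtMost-iter zero    xv reached = isRoot reached
  depthAtMost-iter (suc d) {v} xv reached with v ≟ rootOf v
  ... | yes r  = isRoot r
  ... | no ne =
    let zp , xp , _ = parent-spec xv ne
    in viaParent ne (depthAtMost-iter d xp
         (subst (λ i → iter (parentIn i) d (parent v) ≡ root i) (sym zp)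
                (trans (sym (iter-suc (parentIn (zone v)) d v)) reached)))

  depth≤B : ∀ {v} → X v ≡ false → ∃[ d ] (d ≤ B × DepthAtMost v d)
  depth≤B {v} xv =
    let d , d≤B , reached =
          proj₂ (proj₂ (proj₂ (proj₂ (proj₂ (proj₂ P (zone v)))))) v refl xv
    in d , d≤B , depthAtMost-iter d xv reached

module Climbing {n} (G : Graph n) (X : Fin n → Bool) {B l} {zone : Fin n → Fin l}
                (P : IsBPartition G X B zone) where
  open Evac G X
  open Distance2 G X
  open ZoneTrees G X P

  Child : Fin n → Fin n → Set
  Child w p = w ≢ rootOf w × parent w ≡ p

  child? : ∀ w p → Dec (Child w p)
  child? w p = ¬? (w ≟ rootOf w) ×-dec (parent w ≟ p)

  child-adjacent : ∀ {w p} → X w ≡ false → Child w p → adj G p w ≡ true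
  child-adjacent {w} xw (ne , refl) =
    trans (Graph.sym G (parent w) w) (proj₂ (proj₂ (parent-spec xw ne)))

  module _ (Occupied : Fin n → Set) where

    data Waits (v : Fin n) : Set where
      atRoot         : v ≡ rootOf v → Waits v
      parentOccupied : Occupied (parent v) → Waits v
      yieldsTo       : ∀ {w} → w < v → Child w (parent v) → Occupied w → Waits v

    data Move (v : Fin n) : Fin n → Set where
      climbs : v ≢ rootOf v → ¬ Occupied (parent v) →
               (∀ {w} → w < v → Child w (parent v) → ¬ Occupied w) → Move v (parent v)
      waits  : Waits v → Move v v

  module _ {Occupied : Fin n → Set} {v v′ : Fin n} (xv : X v ≡ false) where

    move-legal : Move Occupied v v′ → v′ ≡ v ⊎ adj G v v′ ≡ true
    move-legal (climbs ne _ _) = inj₂ (proj₂ (proj₂ (parent-spec xv ne)))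
    move-legal (waits _)       = inj₁ refl

    move-inside : Move Occupied v v′ → zone v′ ≡ zone v × X v′ ≡ false
    move-inside (climbs ne _ _) = let zp , xp , _ = parent-spec xv ne in zp , xp
    move-inside (waits _)       = refl , xv

  View : Set
  View = Fin n → Maybe (Fin n)

  Sees : View → Fin n → Set
  Sees vw u = vw u ≢ nothing

  sees? : ∀ vw u → Dec (Sees vw u)
  sees? vw u = ¬? (≡-dec _≟_ (vw u) nothing)

  -- Competing siblings are ordered by vertex identifier.
  decide : (vw : View) (v : Fin n) → ∃ (Move (Sees vw) v)
  decide vw v
    with v ≟ rootOf v | sees? vw (parent v)
       | any? (λ w → w <? v ×-dec child? w (parent v) ×-dec sees? vw w)
  ... | yes r | _     | _                        = v , waits (atRoot r)
  ... | no _  | yes s | _                        = v , waits (parentOccupied s)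
  ... | no _  | no _  | yes (w , lt , ch , s)   = v , waits (yieldsTo lt ch s)
  ... | no ne | no ¬s | no ¬blocked             =
        parent v , climbs ne ¬s (λ lt ch s → ¬blocked (_ , lt , ch , s))

  climbing : Algorithm
  climbing = record
    { State = Fin n
    ; init  = λ _ home → home
    ; step  = λ v vw → proj₁ (decide vw v) , proj₁ (decide vw v)
    }

  module Execution (A : Agents) (valid : ValidAgents A) where
    open Agents A
    open Run climbing A
    open RunFacts G X climbing A

    -- `gone` is ignored: by the invariant no agent ever evacuates.
    Occupied : ℕ → Fin n → Set
    Occupied t u = ∃[ a ] loc (run t) a ≡ u

    data Settled (t : ℕ) (v : Fin n) : Set where
      shallow             : ∀ {d} → d + t ≤ B → DepthAtMost v d → Settled t v
      atRoot              : v ≡ rootOf v → Settled t v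
      parentOccupied      : Occupied t (parent v) → Settled t v
      grandparentOccupied : parent v ≢ rootOf (parent v) → Occupied t (parent (parent v)) →
                            Settled t v

    record Invariant (t : ℕ) : Set where
      field
        present  : ∀ a → gone (run t) a ≡ false
        tracks   : ∀ a → st (run t) a ≡ loc (run t) a
        offExits : ∀ a → X (loc (run t) a) ≡ false
        inZone   : ∀ a → zone (loc (run t) a) ≡ zone (home a)
        distinct : ∀ a b → loc (run t) a ≡ loc (run t) b → a ≡ b
        settled  : ∀ a → Settled t (loc (run t) a)

    invariant-zero : Invariant 0
    invariant-zero = record
      { present  = λ _ → refl
      ; tracks   = λ _ → refl
      ; offExits = homes-offExits
      ; inZone   = λ _ → refl
      ; distinct = homes-distinct
      ; settled  = λ a → let d , d≤B , depth = depth≤B (homes-offExits a)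
                         in shallow (subst (_≤ B) (sym (+-identityʳ d)) d≤B) depth
      }
      where
      homes-distinct : ∀ a b → home a ≡ home b → a ≡ b
      homes-distinct = proj₁ valid
      homes-offExits : ∀ a → X (home a) ≡ false
      homes-offExits = proj₂ (proj₂ valid)

    module Step {t} (inv : Invariant t) where
      open Invariant inv

      c : Config
      c = run t

      loc-suc : ∀ a → loc (run (suc t)) a ≡ target c a
      loc-suc a = loc-next {c} (present a)

      occupied-target : ∀ a → Occupied (suc t) (target c a)
      occupied-target a = a , loc-suc a

      occupied-offExit : ∀ {u} → Occupied t u → X u ≡ false
      occupied-offExit (a , refl) = offExits a

      occupied? : ∀ u → Dec (Occupied t u)
      occupied? u = any? (λ a → loc c a ≟ u)

      sees⇒occupied : ∀ {a u} → Sees (view c a) u → Occupied t u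
      sees⇒occupied {a} {u} s = let b , _ , at-u = view-sound c a u s in b , at-u

      occupied⇒sees : ∀ {a u} → near2 (loc c a) u ≡ true → loc c a ≢ u → Occupied t u →
                      Sees (view c a) u
      occupied⇒sees {a} {u} near ne (b , at-u) = view-complete c a u near ne (present b) at-u

      perceived-move : ∀ a {v′} → Move (Sees (view c a)) (loc c a) v′ →
                       Move (Occupied t) (loc c a) v′
      perceived-move a (waits (atRoot r))         = waits (atRoot r)
      perceived-move a (waits (parentOccupied s)) = waits (parentOccupied (sees⇒occupied s))
      perceived-move a (waits (yieldsTo lt ch s)) = waits (yieldsTo lt ch (sees⇒occupied s))
      perceived-move a (climbs ne ¬s ¬blocked)   =
        climbs ne (¬s ∘ occupied⇒sees (near2-adj v→p) (adj⇒≢ G v→p))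
               (λ lt ch o → ¬blocked lt ch
                 (occupied⇒sees (near2-path v→p (child-adjacent (occupied-offExit o) ch))
                                (≢-sym (<⇒≢ lt)) o))
        where
        v→p : adj G (loc c a) (parent (loc c a)) ≡ true
        v→p = proj₂ (proj₂ (parent-spec (offExits a) ne))

      move-of : ∀ a → Move (Occupied t) (loc c a) (target c a)
      move-of a = perceived-move a
        (subst (λ v → Move (Sees (view c a)) v (target c a)) (tracks a)
               (proj₂ (decide (view c a) (st c a))))

      occupied-step : ∀ {u} → Occupied t u →
                      Occupied (suc t) u ⊎ (u ≢ rootOf u × Occupied (suc t) (parent u))
      occupied-step (a , refl) = follow (move-of a) (occupied-target a)
        where
        follow : ∀ {v′} → Move (Occupied t) (loc c a) v′ → Occupied (suc t) v′ →
                 Occupied (suc t) (loc c a) ⊎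
                 (loc c a ≢ rootOf (loc c a) × Occupied (suc t) (parent (loc c a)))
        follow (climbs ne _ _) o = inj₂ (ne , o)
        follow (waits _)       o = inj₁ o

      parent-filled : ∀ {p w} → ¬ Occupied t p → Child w p → Occupied t w → Occupied (suc t) p
      parent-filled {p} ¬o = go (<-wellFounded _)
        where
        go : ∀ {w} → Acc _<_ w → Child w p → Occupied t w → Occupied (suc t) p
        go (acc smaller) (ne , w→p) (a , refl) = follow (move-of a) (occupied-target a)
          where
          follow : ∀ {v′} → Move (Occupied t) (loc c a) v′ → Occupied (suc t) v′ →
                   Occupied (suc t) p
          follow (climbs _ _ _)               o = subst (Occupied (suc t)) w→p o
          follow (waits (atRoot r))           _ = ⊥-elim (ne r)
          follow (waits (parentOccupied o))   _ = ⊥-elim (¬o (subst (Occupied t) w→p o))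
          follow (waits (yieldsTo lt ch o))   _ = go (smaller lt) (subst (Child _) w→p ch) o

      below-occupied : ∀ {v} → Occupied t (parent v) → Settled (suc t) v
      below-occupied o =
        [ parentOccupied , (λ (ne , o′) → grandparentOccupied ne o′) ] (occupied-step o)

      waiting-settled : ∀ {v} → Waits (Occupied t) v → Settled (suc t) v
      waiting-settled (atRoot r)         = atRoot r
      waiting-settled (parentOccupied o) = below-occupied o
      waiting-settled {v} (yieldsTo _ ch o) with occupied? (parent v)
      ... | yes op = below-occupied op
      ... | no ¬op = parentOccupied (parent-filled ¬op ch o)

      settled-step : ∀ {v v′} → Move (Occupied t) v v′ → Settled t v → Settled (suc t) v′
      settled-step (waits w) _ = waiting-settled w
      settled-step (climbs _ _ _) (shallow {suc d} d+t≤B (viaParent _ depth)) =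
        shallow (subst (_≤ B) (sym (+-suc d t)) d+t≤B) depth
      settled-step (climbs ne _ _) (shallow _ (isRoot r)) = ⊥-elim (ne r)
      settled-step (climbs ne _ _) (atRoot r)           = ⊥-elim (ne r)
      settled-step (climbs _ ¬o _) (parentOccupied o)   = ⊥-elim (¬o o)
      settled-step (climbs _ _ _) (grandparentOccupied _ o) = below-occupied o

      no-collision : ∀ {u u′ v v′} → Occupied t u → Occupied t v → u ≢ v →
                     Move (Occupied t) u u′ → Move (Occupied t) v v′ → u′ ≢ v′
      no-collision ou ov u≢v (climbs nu _ freeU) (climbs nv _ freeV) same with <-cmp _ _
      ... | tri< u<v _ _ = freeV u<v (nu , same) ou
      ... | tri≈ _ u≡v _ = u≢v u≡v
      ... | tri> _ _ v<u = freeU v<u (nv , sym same) ov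
      no-collision _  ov _   (climbs _ ¬o _) (waits _) same = ¬o (subst (Occupied t) (sym same) ov)
      no-collision ou _  _   (waits _) (climbs _ ¬o _) same = ¬o (subst (Occupied t) same ou)
      no-collision _  _  u≢v (waits _) (waits _)       same = u≢v same

      targets-distinct : ∀ a b → a ≢ b → target c a ≢ target c b
      targets-distinct a b a≢b =
        no-collision (a , refl) (b , refl) (a≢b ∘ distinct a b) (move-of a) (move-of b)

      step-valid : ValidStep c
      step-valid = (λ a _ → move-legal (offExits a) (move-of a)) ,
                   λ a b a≢b _ _ → targets-distinct a b a≢b

      invariant-suc : Invariant (suc t)
      invariant-suc = record
        { present  = λ a → trans (gone-next {c} (present a)) (proj₂ (inside a))
        ; tracks   = λ a → trans (st-next {c} (present a)) (sym (loc-suc a))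
        ; offExits = λ a → trans (cong X (loc-suc a)) (proj₂ (inside a))
        ; inZone   = λ a → trans (cong zone (loc-suc a)) (trans (proj₁ (inside a)) (inZone a))
        ; distinct = λ a b same → decidable-stable (a ≟ b) λ a≢b →
            targets-distinct a b a≢b (trans (sym (loc-suc a)) (trans same (loc-suc b)))
        ; settled  = λ a → subst (Settled (suc t)) (sym (loc-suc a))
                                 (settled-step (move-of a) (settled a))
        }
        where
        inside : ∀ a → zone (target c a) ≡ zone (loc c a) × X (target c a) ≡ false
        inside a = move-inside (offExits a) (move-of a)

    invariant : ∀ t → Invariant t
    invariant zero    = invariant-zero
    invariant (suc t) = Step.invariant-suc (invariant t)

    module Grouping (i : Fin l) where
      open Invariant (invariant B)

      c : Config
      c = run B

      Member : Fin n → Set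
      Member u = ∃[ a ] (InAZ zone i A a × gone c a ≡ false ×
                         (loc c a ≡ u ⊎ adj G (loc c a) u ≡ true))

      zone-at : ∀ {a} → InAZ zone i A a → zone (loc c a) ≡ i
      zone-at {a} za = trans (inZone a) za

      resident : ∀ b {u} → loc c b ≡ u → zone u ≡ i → InAZ zone i A b
      resident b at-u zu = trans (sym (inZone b)) (trans (cong zone at-u) zu)

      depth-exhausted : ∀ {v d} → d + B ≤ B → DepthAtMost v d → v ≡ rootOf v
      depth-exhausted _ (isRoot r) = r
      depth-exhausted d+B≤B (viaParent {d = d} _ _) =
        ⊥-elim (1+n≰n (≤-trans (s≤s (m≤n+m B d)) d+B≤B))

      walk-to-root : ∀ {v d} → DepthAtMost v d → ∀ {a} → InAZ zone i A a → loc c a ≡ v →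
                     Walk G Member v (root i)
      walk-to-root {v} (isRoot r) {a} za refl =
        subst (Walk G Member v) (trans r (cong root (zone-at za)))
              (here (a , za , present a , inj₁ refl))
      walk-to-root (viaParent ne depth) {a} za refl with settled a
      ... | shallow d+B≤B depth′ = ⊥-elim (ne (depth-exhausted d+B≤B depth′))
      ... | atRoot r             = ⊥-elim (ne r)
      ... | parentOccupied (b , at-p) =
            let zp , _ , v→p = parent-spec (offExits a) ne
            in next (a , za , present a , inj₁ refl) v→p
                    (walk-to-root depth (resident b at-p (trans zp (zone-at za))) at-p)
      walk-to-root (viaParent _ (isRoot r)) za refl | grandparentOccupied pne _ = ⊥-elim (pne r)
      walk-to-root (viaParent ne (viaParent _ depth)) {a} za refl
        | grandparentOccupied pne (b , at-pp) =
        let zp , xp , v→p = parent-spec (offExits a) ne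
            zpp , _ , p→pp = parent-spec xp pne
        in next (a , za , present a , inj₁ refl) v→p
             (next (a , za , present a , inj₂ v→p) p→pp
               (walk-to-root depth (resident b at-pp (trans zpp (trans zp (zone-at za)))) at-pp))

      agent-to-root : ∀ a → InAZ zone i A a → Walk G Member (loc c a) (root i)
      agent-to-root a za = walk-to-root (proj₂ (proj₂ (depth≤B (offExits a)))) za refl

      member-to-root : ∀ u → Member u → Walk G Member u (root i)
      member-to-root _ (a , za , _ , inj₁ refl)     = agent-to-root a za
      member-to-root u m@(a , za , _ , inj₂ beside) =
        next m (trans (Graph.sym G u (loc c a)) beside) (agent-to-root a za)

      groups : GroupsWithin zone i climbing A B
      groups = B , ≤-refl , (λ t _ → Step.step-valid (invariant t)) , (λ a _ → present a) ,
               connected-via (root i) member-to-root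

lemma2 : {n : ℕ} (G : Graph n) (X : Fin n → Bool) → (∃[ x ] X x ≡ true) →
         (B : ℕ) {l : ℕ} (zone : Fin n → Fin l) → IsBPartition G X B zone →
         (i : Fin l) →
         ∃[ alg ] ((A : Evac.Agents G X) → Evac.ValidAgents G X A →
                   ¬ Evac.SelfSufficient G X zone i B A →
                   Evac.GroupsWithin G X zone i alg A B)
lemma2 G X _ B zone P i =
  climbing , λ A valid _ → Execution.Grouping.groups A valid i
  where open Climbing G X P
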